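{- Let $\mathbf{P}=(P,\le^{\mathbf{P}})$ be a finite poset, let $E_1,\dots,E_r\subseteq P$ be pairwise disjoint nonempty chains of $\mathbf{P}$, and for each $j\in[r]$ let $k_j\le |E_j|$ and $\lambda_j:E_j\to[k_j]$. Let $\mathbf{P}^*=\mathrm{compil}(\mathbf{P},E_1,\dots,E_r,\lambda_1,\dots,\lambda_r)$. Define $s:(E_1\times\cdots\times E_r)^2\to E_1\times\cdots\times E_r$ by $s((c_1,\dots,c_r),(c'_1,\dots,c'_r))=(\min(c_1,c'_1),\dots,\min(c_r,c'_r))$, the minima taken in $\le^{\mathbf{P}}$ (well defined as each $E_j$ is a chain). Then $s$ is a polymorphism of $\mathbf{P}^*$, i.e., for every relation $R$ of $\mathbf{P}^*$ of arity $t$ and all tuples $(a_1,\dots,a_t),(b_1,\dots,b_t)\in R^{\mathbf{P}^*}$, we have $(s(a_1,b_1),\dots,s(a_t,b_t))\in R^{\mathbf{P}^*}$.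
   Context: Compilation. Given $\mathbf{P}$, chains $E_1,\dots,E_r$ and colorings $\lambda_j:E_j\to[k_j]$ as in the claim, $\mathrm{compil}(\mathbf{P},E_1,\dots,E_r,\lambda_1,\dots,\lambda_r)$ is the relational structure with universe $E_1\times\cdots\times E_r$ over the vocabulary consisting of a binary symbol $L$, unary symbols $I_{\{j,j'\}}$ for each 2-element subset $\{j,j'\}\subseteq[r]$, unary symbols $O_{(j,j')}$ for each ordered pair of distinct $j,j'\in[r]$, and binary symbols $R_{(j,k)}$ for $j\in[r]$, $k\in[k_j]$, interpreted as follows, for $\mathbf{c}=(c_1,\dots,c_r)$, $\mathbf{c}'=(c'_1,\dots,c'_r)$: $(\mathbf{c},\mathbf{c}')\in L$ iff $c_j\le^{\mathbf{P}}c'_j$ for all $j\in[r]$; $\mathbf{c}\in I_{\{j,j'\}}$ iff $c_j$ and $c_{j'}$ are incomparable in $\mathbf{P}$; $\mathbf{c}\in O_{(j,j')}$ iff $c_j<^{\mathbf{P}}c_{j'}$; $(\mathbf{c},\mathbf{c}')\in R_{(j,k)}$ iff $(\mathbf{c},\mathbf{c}')\in L$, $\lambda_j(c_j)=k$ and $c_j=c'_j$. -}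

module Defs where

open import Level using (Level)
open import Data.Nat using (ℕ)
open import Data.Fin using (Fin)
open import Data.Fin.Subset using (Subset; _∈_)
open import Data.Product using (Σ; _×_; proj₁; _,_)
open import Data.Empty using (⊥)
open import Relation.Nullary using (¬_; does)
open import Relation.Binary using (Rel; IsDecPartialOrder)
open import Relation.Binary.PropositionalEquality using (_≡_; _≢_)
open import Data.Bool using (if_then_else_)

-- The poset P is (Fin n, _≤_) with _≤_ a decidable partial order w.r.t. _≡_.
-- Chains are subsets of Fin n.

Elt : {n : ℕ} → Subset n → Set
Elt {n} E = Σ (Fin n) (λ x → x ∈ E)

IsChain : ∀ {ℓ} {n : ℕ} → Rel (Fin n) ℓ → Subset n → Set ℓ
IsChain _≤_ E = ∀ x y → x ∈ E → y ∈ E → (x ≤ y) Data.Sum.⊎ (y ≤ x)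
  where import Data.Sum

PairwiseDisjoint : {n r : ℕ} → (Fin r → Subset n) → Set
PairwiseDisjoint {n} {r} E = ∀ (j j' : Fin r) (x : Fin n) → j ≢ j' → x ∈ E j → x ∈ E j' → ⊥

Univ : {n r : ℕ} → (Fin r → Subset n) → Set
Univ E = (j : _) → Elt (E j)

-- Vocabulary of compil(P, E_1..E_r, λ_1..λ_r).
-- I_{j,j'} is indexed by an ordered pair of distinct indices; I (j,j') and
-- I (j',j) denote the same relation (the 2-element subset {j,j'}).
data Sym (r : ℕ) (k : Fin r → ℕ) : Set where
  L : Sym r k
  I : (j j' : Fin r) → j ≢ j' → Sym r k
  O : (j j' : Fin r) → j ≢ j' → Sym r k
  R : (j : Fin r) → Fin (k j) → Sym r k

arity : {r : ℕ} {k : Fin r → ℕ} → Sym r k → ℕ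
arity L         = 2
arity (I _ _ _) = 1
arity (O _ _ _) = 1
arity (R _ _)   = 2

module Compil {ℓ} {n r : ℕ} (_≤_ : Rel (Fin n) ℓ)
              (E : Fin r → Subset n) (k : Fin r → ℕ)
              (col : (j : Fin r) → Elt (E j) → Fin (k j)) where

  Lrel : Univ E → Univ E → Set ℓ
  Lrel c c' = ∀ j → proj₁ (c j) ≤ proj₁ (c' j)

  Incomparable : Fin n → Fin n → Set ℓ
  Incomparable x y = ¬ (x ≤ y) × ¬ (y ≤ x)

  _<_ : Fin n → Fin n → Set ℓ
  x < y = (x ≤ y) × (x ≢ y)

  interp : (S : Sym r k) → (Fin (arity S) → Univ E) → Set ℓ
  interp L         a = Lrel (a Fin.zero) (a (Fin.suc Fin.zero))
    where import Data.Fin as Fin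
  interp (I j j' _) a = Incomparable (proj₁ (a Fin.zero j)) (proj₁ (a Fin.zero j'))
    where import Data.Fin as Fin
  interp (O j j' _) a = proj₁ (a Fin.zero j) < proj₁ (a Fin.zero j')
    where import Data.Fin as Fin
  interp (R j κ)    a =
    Lrel c c' × ((col j (c j) ≡ κ) Data.Product.× (proj₁ (c j) ≡ proj₁ (c' j)))
    where import Data.Fin as Fin
          import Data.Product
          c  = a Fin.zero
          c' = a (Fin.suc Fin.zero)

  IsPolymorphism : (Univ E → Univ E → Univ E) → Set ℓ
  IsPolymorphism f = ∀ (S : Sym r k) (a b : Fin (arity S) → Univ E)
    → interp S a → interp S b → interp S (λ i → f (a i) (b i))

module _ {ℓ} {n : ℕ} {_≤_ : Rel (Fin n) ℓ} (po : IsDecPartialOrder _≡_ _≤_) where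
  open IsDecPartialOrder po using (_≤?_)

  minElt : {E : Subset n} → Elt E → Elt E → Elt E
  minElt x y = if does (proj₁ x ≤? proj₁ y) then x else y

  sMin : {r : ℕ} {E : Fin r → Subset n} → Univ E → Univ E → Univ E
  sMin c c' j = minElt (c j) (c' j)

module Submission where

-- On a chain E of the poset, the binary minimum
-- 'minElt' always returns one of its two arguments, namely the smaller one.
-- Consequently (i) it is a greatest lower bound, hence monotone, and (ii) any
-- property shared by both arguments (such as having colour κ) is inherited by
-- the minimum.  The map s = sMin acts coordinatewise by these minima, so each
-- relation of compil(P, E₁..E_r, λ₁..λ_r) is preserved by a short argument:
--   L       by monotonicity of the minimum in every coordinate;
--   I       since if min(x,y) ≤ min(x',y') then x ≤ x' or y ≤ y';
--   O       by monotonicity, strictness coming from disjointness of chains;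
--   R(j,κ)  by monotonicity, inheritance of the colour, and the fact that
--           the minimum only depends on the underlying points of P.
-- The file first develops the order theory of 'minElt' on chains
-- (module MinimumOnChains), then the preservation of each relation
-- (module Preservation), and finally assembles the theorem lemma1.

open import Defs
open import Level using (Level)
open import Data.Nat using (ℕ) renaming (_≤_ to _≤ℕ_)
open import Data.Fin using (Fin; zero; suc)
open import Data.Fin.Subset using (Subset; Nonempty; ∣_∣)
open import Data.Product using (_×_; _,_; proj₁; proj₂)
open import Data.Sum using (_⊎_; inj₁; inj₂)
open import Relation.Binary using (Rel; IsDecPartialOrder)
open import Relation.Binary.PropositionalEquality using (_≡_; _≢_; refl; sym; subst)
open import Relation.Nullary using (¬_; yes; no)
open import Data.Empty using (⊥-elim)

module MinimumOnChains {ℓ} {n : ℕ} {_≤_ : Rel (Fin n) ℓ}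
                       (po : IsDecPartialOrder _≡_ _≤_) where
  open IsDecPartialOrder po using (_≤?_) renaming (refl to ≤-refl; trans to ≤-trans)

  min-cases : {E : Subset n} → IsChain _≤_ E → (x y : Elt E)
            → (minElt po x y ≡ x × proj₁ x ≤ proj₁ y)
            ⊎ (minElt po x y ≡ y × proj₁ y ≤ proj₁ x)
  min-cases ch x y with proj₁ x ≤? proj₁ y
  ... | yes x≤y = inj₁ (refl , x≤y)
  ... | no x≰y with ch (proj₁ x) (proj₁ y) (proj₂ x) (proj₂ y)
  ...   | inj₁ x≤y = ⊥-elim (x≰y x≤y)
  ...   | inj₂ y≤x = inj₂ (refl , y≤x)

  min-preserves : ∀ {p} {E : Subset n} → IsChain _≤_ E → (P : Elt E → Set p)
                → {x y : Elt E} → P x → P y → P (minElt po x y)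
  min-preserves ch P {x} {y} px py with min-cases ch x y
  ... | inj₁ (min≡x , _) = subst P (sym min≡x) px
  ... | inj₂ (min≡y , _) = subst P (sym min≡y) py

  min-≤ˡ : {E : Subset n} → IsChain _≤_ E → (x y : Elt E)
         → proj₁ (minElt po x y) ≤ proj₁ x
  min-≤ˡ ch x y with min-cases ch x y
  ... | inj₁ (min≡x , _)   = subst (λ m → proj₁ m ≤ proj₁ x) (sym min≡x) ≤-refl
  ... | inj₂ (min≡y , y≤x) = subst (λ m → proj₁ m ≤ proj₁ x) (sym min≡y) y≤x

  min-≤ʳ : {E : Subset n} → IsChain _≤_ E → (x y : Elt E)
         → proj₁ (minElt po x y) ≤ proj₁ y
  min-≤ʳ ch x y with min-cases ch x y
  ... | inj₁ (min≡x , x≤y) = subst (λ m → proj₁ m ≤ proj₁ y) (sym min≡x) x≤y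
  ... | inj₂ (min≡y , _)   = subst (λ m → proj₁ m ≤ proj₁ y) (sym min≡y) ≤-refl

  -- It is the greatest lower bound (being one of the two arguments).
  min-glb : {E : Subset n} → IsChain _≤_ E → (z : Fin n) {x y : Elt E}
          → z ≤ proj₁ x → z ≤ proj₁ y → z ≤ proj₁ (minElt po x y)
  min-glb ch z = min-preserves ch (λ m → z ≤ proj₁ m)

  min-mono : {E E' : Subset n} → IsChain _≤_ E → IsChain _≤_ E'
           → {x y : Elt E} {x' y' : Elt E'}
           → proj₁ x ≤ proj₁ x' → proj₁ y ≤ proj₁ y'
           → proj₁ (minElt po x y) ≤ proj₁ (minElt po x' y')
  min-mono ch ch' {x} {y} x≤x' y≤y' =
    min-glb ch' _ (≤-trans (min-≤ˡ ch x y) x≤x') (≤-trans (min-≤ʳ ch x y) y≤y')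

  -- If min(x,y) ≤ min(x',y') then x ≤ x' or y ≤ y': the minimum on the left
  -- is x or y, and the one on the right lies below both x' and y'.
  min-not-below : {E E' : Subset n} → IsChain _≤_ E → IsChain _≤_ E'
                → {x y : Elt E} {x' y' : Elt E'}
                → ¬ proj₁ x ≤ proj₁ x' → ¬ proj₁ y ≤ proj₁ y'
                → ¬ proj₁ (minElt po x y) ≤ proj₁ (minElt po x' y')
  min-not-below ch ch' {x' = x'} {y'} x≰x' y≰y' =
    min-preserves ch (λ m → ¬ proj₁ m ≤ proj₁ (minElt po x' y'))
      (λ x≤min → x≰x' (≤-trans x≤min (min-≤ˡ ch' x' y')))
      (λ y≤min → y≰y' (≤-trans y≤min (min-≤ʳ ch' x' y')))

  min-point-cong : {E : Subset n} (x y x' y' : Elt E)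
                 → proj₁ x ≡ proj₁ x' → proj₁ y ≡ proj₁ y'
                 → proj₁ (minElt po x y) ≡ proj₁ (minElt po x' y')
  min-point-cong (a , _) (b , _) (.a , _) (.b , _) refl refl with a ≤? b
  ... | yes _ = refl
  ... | no _  = refl

disjoint-distinct : {n r : ℕ} {E : Fin r → Subset n} → PairwiseDisjoint E
                  → {j j' : Fin r} → j ≢ j' → (x : Elt (E j)) (x' : Elt (E j'))
                  → proj₁ x ≢ proj₁ x'
disjoint-distinct disj {j} {j'} j≢j' (a , a∈E) (_ , b∈E') refl =
  disj j j' a j≢j' a∈E b∈E'

module Preservation {ℓ} {n r : ℕ} {_≤_ : Rel (Fin n) ℓ}
                    (po : IsDecPartialOrder _≡_ _≤_)
                    {E : Fin r → Subset n} (chain : ∀ j → IsChain _≤_ (E j))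
                    (k : Fin r → ℕ) (col : (j : Fin r) → Elt (E j) → Fin (k j)) where
  open IsDecPartialOrder po using () renaming (trans to ≤-trans)
  open MinimumOnChains po
  open Compil _≤_ E k col

  s : Univ E → Univ E → Univ E
  s = sMin po

  point : Univ E → (j : Fin r) → Fin n
  point c j = proj₁ (c j)

  L-preserved : {c c' d d' : Univ E} → Lrel c c' → Lrel d d' → Lrel (s c d) (s c' d')
  L-preserved c≤c' d≤d' j = min-mono (chain j) (chain j) (c≤c' j) (d≤d' j)

  I-preserved : (j j' : Fin r) {c d : Univ E}
              → Incomparable (point c j) (point c j')
              → Incomparable (point d j) (point d j')
              → Incomparable (point (s c d) j) (point (s c d) j')
  I-preserved j j' (c≰ , c≱) (d≰ , d≱) =
    min-not-below (chain j) (chain j') c≰ d≰ , min-not-below (chain j') (chain j) c≱ d≱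

  O-preserved : PairwiseDisjoint E → {j j' : Fin r} → j ≢ j' → {c d : Univ E}
              → point c j < point c j' → point d j < point d j'
              → point (s c d) j < point (s c d) j'
  O-preserved disj {j} {j'} j≢j' {c} {d} (c≤ , _) (d≤ , _) =
      min-glb (chain j') _ (≤-trans (min-≤ˡ (chain j) (c j) (d j)) c≤)
                           (≤-trans (min-≤ʳ (chain j) (c j) (d j)) d≤)
    , disjoint-distinct disj j≢j' (s c d j) (s c d j')

  -- The two conjuncts of R(j,κ) beyond L: colour κ and equal j-th point.
  R-preserved : (j : Fin r) (κ : Fin (k j)) (c c' d d' : Univ E)
              → col j (c j) ≡ κ × point c j ≡ point c' j
              → col j (d j) ≡ κ × point d j ≡ point d' j
              → col j (s c d j) ≡ κ × point (s c d) j ≡ point (s c' d') j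
  R-preserved j κ c c' d d' (cκ , c≡c') (dκ , d≡d') =
      min-preserves (chain j) (λ m → col j m ≡ κ) cκ dκ
    , min-point-cong (c j) (d j) (c' j) (d' j) c≡c' d≡d'

lemma1 : ∀ {ℓ : Level} (n : ℕ) (_≤_ : Rel (Fin n) ℓ) (po : IsDecPartialOrder _≡_ _≤_)
    (r : ℕ) (E : Fin r → Subset n)
    → (∀ j → Nonempty (E j))
    → (∀ j → IsChain _≤_ (E j))
    → PairwiseDisjoint E
    → (k : Fin r → ℕ)
    → (∀ j → k j ≤ℕ ∣ E j ∣)
    → (col : (j : Fin r) → Elt (E j) → Fin (k j))
    → Compil.IsPolymorphism _≤_ E k col (sMin po)
lemma1 n _≤_ po r E _ chain disj k _ col = polymorphism
  where
  open Preservation po chain k col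
  open Compil _≤_ E k col using (IsPolymorphism)

  polymorphism : IsPolymorphism (sMin po)
  polymorphism L          a b la lb = L-preserved la lb
  polymorphism (I j j' _) a b ia ib = I-preserved j j' ia ib
  polymorphism (O _ _ j≢j') a b oa ob = O-preserved disj j≢j' oa ob
  polymorphism (R j κ)    a b (la , ra) (lb , rb) =
    L-preserved la lb , R-preserved j κ (a zero) (a (suc zero)) (b zero) (b (suc zero)) ra rb
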